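{- For every positive integer $n$, $\kappa_{id}(K_n)\ge C_n$, where $C_n=\frac{1}{n+1}\binom{2n}{n}$ is the $n$-th Catalan number.
   Context: An infinite permutation of $\mathbb{N}$ is a sequence $(\pi(1),\pi(2),\dots)$ in which every positive integer occurs exactly once. $K_n$ denotes the complete graph on vertex set $[n]=\{1,\dots,n\}$. Two infinite permutations $\pi,\sigma$ are $K_n$-different if there is a position $i$ with $\pi(i)\ne\sigma(i)$ and $\pi(i),\sigma(i)\in[n]$. $\kappa_{id}(K_n)$ is the maximum number of pairwise $K_n$-different infinite permutations in each of which the numbers $1,2,\dots,n$ appear in their natural order (i.e. $1$ occurs in an earlier position than $2$, which occurs earlier than $3$, etc.). -}

module Defs where

open import Data.Nat using (ℕ; suc; _*_; _<_; _/_)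
open import Data.Nat.Combinatorics using (_C_)
open import Data.Fin using (Fin)
open import Data.Product using (Σ; ∃; _×_)
open import Relation.Binary.PropositionalEquality using (_≡_)
open import Relation.Nullary using (¬_)
open import Function.Bundles using (_⤖_; Bijection)

-- Encoding: the positive integers {1,2,3,...} are represented by ℕ = {0,1,2,...}
-- via k ↦ k+1 (both for positions and for values).  Hence [n] = {1..n}
-- corresponds to the values v with v < n.

InfPerm : Set
InfPerm = ℕ ⤖ ℕ

entry : InfPerm → ℕ → ℕ
entry π = Bijection.to π

KnDifferent : ℕ → InfPerm → InfPerm → Set
KnDifferent n π σ =
  ∃ λ i → ¬ (entry π i ≡ entry σ i) × entry π i < n × entry σ i < n

IdOrdered : ℕ → InfPerm → Set
IdOrdered n π = ∀ i j → entry π i < n → entry π j < n → entry π i < entry π j → i < j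

-- The n-th Catalan number C_n = binom(2n, n) / (n+1)  (exact division).
Catalan : ℕ → ℕ
Catalan n = ((2 * n) C n) / suc n

KappaIdAtLeast : ℕ → ℕ → Set
KappaIdAtLeast n m =
  Σ (Fin m → InfPerm) λ f →
    (∀ k → IdOrdered n (f k)) ×
    (∀ k l → ¬ (k ≡ l) → KnDifferent n (f k) (f l))

-- Binary trees with n internal nodes are counted by C_n: writing F(s, k) for
-- the number of forests of k binary trees with s internal nodes in total,
-- F(s, j + 1) is the ballot number C(2s+j, s) - C(2s+j, s-1), so F(n, 1) = C_n.
-- Lay a tree out in symmetric order on the positions 0, 1, 2, ...: a subtree
-- with m internal nodes laid out from offset o uses positions in
-- [o, o + 2^m - 1) and puts its root at o + 2^(m-1) - 1, which depends on m only.
-- The permutation of a tree places the value i at the position of its i-th node,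
-- so 0, ..., n-1 occur in increasing order.  Two distinct trees of equal size have
-- their roots at the same position, carrying the sizes of the left subtrees as
-- values; if these agree, the first pair of differing subtrees again has equal
-- sizes and equal offsets, and we recurse.
module Submission where

open import Data.Fin using (Fin; zero; splitAt; join; cast)
open import Data.Fin.Properties using (join-splitAt; cast-involutive)
open import Data.List using (List; []; _∷_; _++_; length)
open import Data.List.Properties using (length-++; length-++-≤ˡ)
open import Data.Nat
open import Data.Nat.Combinatorics
open import Data.Nat.DivMod using (m*n/n≡m)
open import Data.Nat.Properties
open import Data.Nat.Tactic.RingSolver using (solve-∀)
open import Data.Product using (_×_; _,_)
open import Data.Sum using (inj₁; inj₂; [_,_]; [_,_]′)
open import Data.Vec using (Vec; []; _∷_; head)
open import Data.Vec.Properties using (∷-injectiveʳ)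
open import Function using (_∘_; _↔_; Inverse; mk↔ₛ′; Bijection)
open import Function.Construct.Composition using (_↔-∘_)
open import Function.Construct.Identity using (↔-id)
open import Function.Definitions using (Injective)
open import Function.Properties.Inverse using (↔⇒⤖)
open import Relation.Binary.Definitions using (DecidableEquality)
open import Relation.Binary.PropositionalEquality
open import Relation.Nullary using (yes; no; contradiction)

open import Defs

open ≡-Reasoning

-- The number of forests of k binary trees with s internal nodes in total:
-- the first tree is either a leaf or a node whose two subtrees are put in front
-- of the remaining k - 1 trees.
forestCount : ℕ → ℕ → ℕ
forestCount zero    zero    = 1
forestCount (suc s) zero    = 0
forestCount zero    (suc k) = forestCount zero k
forestCount (suc s) (suc k) = forestCount (suc s) k + forestCount s (suc (suc k))

forestCount-zero : ∀ k → forestCount zero k ≡ 1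
forestCount-zero zero    = refl
forestCount-zero (suc k) = forestCount-zero k

infixl 6.5 _C⁻_

_C⁻_ : ℕ → ℕ → ℕ
m C⁻ zero  = 0
m C⁻ suc s = m C s

[1+m]Cs≡mC⁻s+mCs : ∀ m s → suc m C s ≡ m C⁻ s + m C s
[1+m]Cs≡mC⁻s+mCs m zero    = refl
[1+m]Cs≡mC⁻s+mCs m (suc s) = sym (nCk+nC[k+1]≡[n+1]C[k+1] m s)

[k+l]Ck≡[k+l]Cl : ∀ k l → (k + l) C k ≡ (k + l) C l
[k+l]Ck≡[k+l]Cl k l = trans (nCk≡nC[n∸k] (m≤m+n k l)) (cong ((k + l) C_) (m+n∸m≡n k l))

[1+k]*[1+m]C[1+k]≡[1+m]*mCk : ∀ m k → suc k * (suc m C suc k) ≡ suc m * (m C k)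
[1+k]*[1+m]C[1+k]≡[1+m]*mCk zero    zero    = refl
[1+k]*[1+m]C[1+k]≡[1+m]*mCk zero    (suc k) = begin
  suc (suc k) * (1 C suc (suc k)) ≡⟨ cong (suc (suc k) *_) (k>n⇒nCk≡0 (s≤s (s≤s (z≤n {k})))) ⟩
  suc (suc k) * 0                 ≡⟨ *-zeroʳ (suc (suc k)) ⟩
  0                               ≡⟨ cong (1 *_) (k>n⇒nCk≡0 (s≤s (z≤n {k}))) ⟨
  1 * (0 C suc k)                 ∎
[1+k]*[1+m]C[1+k]≡[1+m]*mCk (suc m) zero    =
  trans (*-identityˡ _) (trans (nC1≡n (suc (suc m))) (sym (*-identityʳ _)))
[1+k]*[1+m]C[1+k]≡[1+m]*mCk (suc m) (suc k) = begin
  suc (suc k) * (suc (suc m) C suc (suc k))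
    ≡⟨ cong (suc (suc k) *_) (nCk+nC[k+1]≡[n+1]C[k+1] (suc m) (suc k)) ⟨
  suc (suc k) * (a + suc m C suc (suc k))
    ≡⟨ *-distribˡ-+ (suc (suc k)) a _ ⟩
  (a + suc k * a) + suc (suc k) * (suc m C suc (suc k))
    ≡⟨ cong₂ (λ x y → (a + x) + y) ([1+k]*[1+m]C[1+k]≡[1+m]*mCk m k)
                                    ([1+k]*[1+m]C[1+k]≡[1+m]*mCk m (suc k)) ⟩
  (a + suc m * (m C k)) + suc m * (m C suc k)
    ≡⟨ +-assoc a _ _ ⟩
  a + (suc m * (m C k) + suc m * (m C suc k))
    ≡⟨ cong (a +_) (*-distribˡ-+ (suc m) (m C k) (m C suc k)) ⟨
  a + suc m * (m C k + m C suc k)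
    ≡⟨ cong (λ x → a + suc m * x) (nCk+nC[k+1]≡[n+1]C[k+1] m k) ⟩
  suc (suc m) * a ∎
  where
  a : ℕ
  a = suc m C suc k

[1+k]*[1+k+l]C[1+k]≡[1+l]*[1+k+l]Ck : ∀ k l → suc k * (suc (k + l) C suc k) ≡ suc l * (suc (k + l) C k)
[1+k]*[1+k+l]C[1+k]≡[1+l]*[1+k+l]Ck k l = begin
  suc k * (suc (k + l) C suc k) ≡⟨ [1+k]*[1+m]C[1+k]≡[1+m]*mCk (k + l) k ⟩
  suc (k + l) * ((k + l) C k)   ≡⟨ cong (suc (k + l) *_) ([k+l]Ck≡[k+l]Cl k l) ⟩
  suc (k + l) * ((k + l) C l)   ≡⟨ [1+k]*[1+m]C[1+k]≡[1+m]*mCk (k + l) l ⟨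
  suc l * (suc (k + l) C suc l) ≡⟨ cong (λ m → suc l * (m C suc l)) (+-suc k l) ⟨
  suc l * ((k + suc l) C suc l) ≡⟨ cong (suc l *_) ([k+l]Ck≡[k+l]Cl k (suc l)) ⟨
  suc l * ((k + suc l) C k)     ≡⟨ cong (λ m → suc l * (m C k)) (+-suc k l) ⟩
  suc l * (suc (k + l) C k)     ∎

-- The top index m is given through an equation so that each recursive call can
-- choose the most convenient form of j + 2s.
ballot : ∀ s j {m} → m ≡ j + (s + s) → forestCount s (suc j) + m C⁻ s ≡ m C s
ballot zero    j       _       = cong (_+ 0) (forestCount-zero (suc j))
ballot (suc s) zero    {zero}  ()
ballot (suc s) (suc j) {zero}  ()
ballot (suc s) zero    {suc m} eq = begin
  forestCount s 2 + suc m C s        ≡⟨ cong (forestCount s 2 +_) ([1+m]Cs≡mC⁻s+mCs m s) ⟩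
  forestCount s 2 + (m C⁻ s + m C s) ≡⟨ +-assoc (forestCount s 2) _ _ ⟨
  forestCount s 2 + m C⁻ s + m C s   ≡⟨ cong (_+ m C s) (ballot s 1 (trans m≡ (+-suc s s))) ⟩
  m C s + m C s                      ≡⟨ cong (m C s +_) central ⟩
  m C s + m C suc s                  ≡⟨ nCk+nC[k+1]≡[n+1]C[k+1] m s ⟩
  suc m C suc s                      ∎
  where
  m≡ : m ≡ s + suc s
  m≡ = suc-injective eq
  central : m C s ≡ m C suc s
  central = subst (λ x → x C s ≡ x C suc s) (sym m≡) ([k+l]Ck≡[k+l]Cl s (suc s))
ballot (suc s) (suc j) {suc m} eq = begin
  a + b + suc m C s          ≡⟨ cong (a + b +_) ([1+m]Cs≡mC⁻s+mCs m s) ⟩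
  a + b + (m C⁻ s + m C s)   ≡⟨ interchange a b (m C⁻ s) (m C s) ⟩
  (a + m C s) + (b + m C⁻ s) ≡⟨ cong₂ _+_ (ballot (suc s) j (suc-injective eq)) (ballot s (2 + j) m≡) ⟩
  m C suc s + m C s          ≡⟨ +-comm (m C suc s) _ ⟩
  m C s + m C suc s          ≡⟨ nCk+nC[k+1]≡[n+1]C[k+1] m s ⟩
  suc m C suc s              ∎
  where
  a b : ℕ
  a = forestCount (suc s) (suc j)
  b = forestCount s (3 + j)
  interchange : ∀ a b c d → a + b + (c + d) ≡ (a + d) + (b + c)
  interchange = solve-∀
  shift : ∀ s j → j + (suc s + suc s) ≡ 2 + j + (s + s)
  shift = solve-∀
  m≡ : m ≡ 2 + j + (s + s)
  m≡ = trans (suc-injective eq) (shift s j)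

[1+n]*forestCount≡[2n]Cn : ∀ n → suc n * forestCount n 1 ≡ (2 * n) C n
[1+n]*forestCount≡[2n]Cn zero    = refl
[1+n]*forestCount≡[2n]Cn (suc n) = solve-for-f (suc n) (forestCount (suc n) 1) (ballot (suc n) 0 2n≡) ratio
  where
  2n≡ : 2 * suc n ≡ 0 + (suc n + suc n)
  2n≡ = cong (suc n +_) (+-identityʳ (suc n))
  ratio : suc (suc n) * ((2 * suc n) C n) ≡ suc n * ((2 * suc n) C suc n)
  ratio = subst (λ m → suc (suc n) * (m C n) ≡ suc n * (m C suc n)) (sym 2n≡)
            (sym ([1+k]*[1+k+l]C[1+k]≡[1+l]*[1+k+l]Ck n (suc n)))
  solve-for-f : ∀ a f {y x} → f + y ≡ x → suc a * y ≡ a * x → suc a * f ≡ x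
  solve-for-f a f {y} {x} f+y≡x ay≡ax = +-cancelʳ-≡ (a * x) _ _ (begin
    suc a * f + a * x     ≡⟨ cong (suc a * f +_) ay≡ax ⟨
    suc a * f + suc a * y ≡⟨ *-distribˡ-+ (suc a) f y ⟨
    suc a * (f + y)       ≡⟨ cong (suc a *_) f+y≡x ⟩
    suc a * x             ∎)

Catalan≡forestCount : ∀ n → Catalan n ≡ forestCount n 1
Catalan≡forestCount n = begin
  ((2 * n) C n) / suc n           ≡⟨ cong (_/ suc n) ([1+n]*forestCount≡[2n]Cn n) ⟨
  suc n * forestCount n 1 / suc n ≡⟨ cong (_/ suc n) (*-comm (suc n) (forestCount n 1)) ⟩
  forestCount n 1 * suc n / suc n ≡⟨ m*n/n≡m (forestCount n 1) (suc n) ⟩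
  forestCount n 1                 ∎

data Tree : Set where
  leaf : Tree
  node : Tree → Tree → Tree

size : Tree → ℕ
size leaf       = 0
size (node l r) = suc (size l + size r)

infix 4 _≟ᵀ_

_≟ᵀ_ : DecidableEquality Tree
leaf     ≟ᵀ leaf       = yes refl
leaf     ≟ᵀ node _ _   = no λ ()
node _ _ ≟ᵀ leaf       = no λ ()
node l r ≟ᵀ node l′ r′ with l ≟ᵀ l′ | r ≟ᵀ r′
... | yes refl | yes refl = yes refl
... | no l≢l′  | _        = no λ { refl → l≢l′ refl }
... | yes _    | no r≢r′  = no λ { refl → r≢r′ refl }

forestSize : ∀ {k} → Vec Tree k → ℕ
forestSize []       = 0
forestSize (t ∷ ts) = size t + forestSize ts

graft : ∀ {k} → Vec Tree (2 + k) → Vec Tree (1 + k)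
graft (l ∷ r ∷ ts) = node l r ∷ ts

forestSize-graft : ∀ {k} (ts : Vec Tree (2 + k)) → forestSize (graft ts) ≡ suc (forestSize ts)
forestSize-graft (l ∷ r ∷ ts) = cong suc (+-assoc (size l) (size r) (forestSize ts))

graft-injective : ∀ {k} (ts us : Vec Tree (2 + k)) → graft ts ≡ graft us → ts ≡ us
graft-injective (l ∷ r ∷ ts) (.l ∷ .r ∷ .ts) refl = refl

leaf∷≢graft : ∀ {k} (ts : Vec Tree k) us → leaf ∷ ts ≢ graft us
leaf∷≢graft ts (l ∷ r ∷ us) ()

[,]′-injective : ∀ {a b c} {A : Set a} {B : Set b} {C : Set c} {f : A → C} {g : B → C} →
                 Injective _≡_ _≡_ f → Injective _≡_ _≡_ g → (∀ x y → f x ≢ g y) →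
                 Injective _≡_ _≡_ [ f , g ]′
[,]′-injective f-inj g-inj f≢g {inj₁ x} {inj₁ x′} eq = cong inj₁ (f-inj eq)
[,]′-injective f-inj g-inj f≢g {inj₁ x} {inj₂ y}  eq = contradiction eq (f≢g x y)
[,]′-injective f-inj g-inj f≢g {inj₂ y} {inj₁ x}  eq = contradiction (sym eq) (f≢g x y)
[,]′-injective f-inj g-inj f≢g {inj₂ y} {inj₂ y′} eq = cong inj₂ (g-inj eq)

splitAt-injective : ∀ m {n} → Injective _≡_ _≡_ (splitAt m {n})
splitAt-injective m {n} {i} {j} eq =
  trans (sym (join-splitAt m n i)) (trans (cong (join m n) eq) (join-splitAt m n j))

decode : ∀ s k → Fin (forestCount s k) → Vec Tree k
decode zero    zero    _ = []
decode zero    (suc k) i = leaf ∷ decode zero k i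
decode (suc s) zero    ()
decode (suc s) (suc k) i =
  [ (λ a → leaf ∷ decode (suc s) k a) , (λ b → graft (decode s (2 + k) b)) ]′
    (splitAt (forestCount (suc s) k) i)

forestSize-decode : ∀ s k i → forestSize (decode s k i) ≡ s
forestSize-decode zero    zero    _ = refl
forestSize-decode zero    (suc k) i = forestSize-decode zero k i
forestSize-decode (suc s) zero    ()
forestSize-decode (suc s) (suc k) i =
  [_,_] {C = λ x → forestSize ([ _ , _ ]′ x) ≡ suc s}
    (λ a → forestSize-decode (suc s) k a)
    (λ b → trans (forestSize-graft (decode s (2 + k) b)) (cong suc (forestSize-decode s (2 + k) b)))
    (splitAt (forestCount (suc s) k) i)

decode-injective : ∀ s k → Injective _≡_ _≡_ (decode s k)
decode-injective zero    zero    {zero} {zero} _ = refl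
decode-injective zero    (suc k) eq = decode-injective zero k (∷-injectiveʳ eq)
decode-injective (suc s) zero    {()}
decode-injective (suc s) (suc k) eq = splitAt-injective (forestCount (suc s) k)
  ([,]′-injective (decode-injective (suc s) k ∘ ∷-injectiveʳ)
                  (decode-injective s (2 + k) ∘ graft-injective _ _)
                  (λ _ _ → leaf∷≢graft _ _)
                  eq)

size-head : (ts : Vec Tree 1) → size (head ts) ≡ forestSize ts
size-head (t ∷ []) = sym (+-identityʳ (size t))

head-injective : ∀ {a} {A : Set a} → Injective _≡_ _≡_ (head {A = A} {n = 0})
head-injective {x = x ∷ []} {y ∷ []} refl = refl

catalanTree : ∀ n → Fin (Catalan n) → Tree
catalanTree n = head ∘ decode n 1 ∘ cast (Catalan≡forestCount n)

size-catalanTree : ∀ n k → size (catalanTree n k) ≡ n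
size-catalanTree n k = trans (size-head (decode n 1 i)) (forestSize-decode n 1 i)
  where
  i : Fin (forestCount n 1)
  i = cast (Catalan≡forestCount n) k

catalanTree-injective : ∀ n → Injective _≡_ _≡_ (catalanTree n)
catalanTree-injective n {k} {l} eq = begin
  k                       ≡⟨ cast-involutive (sym e) e k ⟨
  cast (sym e) (cast e k) ≡⟨ cong (cast (sym e)) (decode-injective n 1 (head-injective eq)) ⟩
  cast (sym e) (cast e l) ≡⟨ cast-involutive (sym e) e l ⟩
  l                       ∎
  where
  e : Catalan n ≡ forestCount n 1
  e = Catalan≡forestCount n

nth : List ℕ → ℕ → ℕ
nth []       _       = 0
nth (x ∷ xs) zero    = x
nth (x ∷ xs) (suc i) = nth xs i

nth-++ˡ : ∀ xs ys {i} → i < length xs → nth (xs ++ ys) i ≡ nth xs i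
nth-++ˡ (x ∷ xs) ys {zero}  _         = refl
nth-++ˡ (x ∷ xs) ys {suc i} (s≤s i<n) = nth-++ˡ xs ys i<n

nth-++-length : ∀ xs y ys → nth (xs ++ y ∷ ys) (length xs) ≡ y
nth-++-length []       y ys = refl
nth-++-length (x ∷ xs) y ys = nth-++-length xs y ys

nth-++-∷ʳ : ∀ xs y ys i → nth (xs ++ y ∷ ys) (length xs + suc i) ≡ nth ys i
nth-++-∷ʳ []       y ys i = refl
nth-++-∷ʳ (x ∷ xs) y ys i = nth-++-∷ʳ xs y ys i

data Ascending : ℕ → ℕ → List ℕ → Set where
  []  : ∀ {a c} → Ascending a c []
  _∷_ : ∀ {a c p ps} → a ≤ p × p < c → Ascending (suc p) c ps → Ascending a c (p ∷ ps)

Ascending-weakenˡ : ∀ {a b c ps} → a ≤ b → Ascending b c ps → Ascending a c ps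
Ascending-weakenˡ a≤b []                  = []
Ascending-weakenˡ a≤b ((b≤p , p<c) ∷ asc) = (≤-trans a≤b b≤p , p<c) ∷ asc

Ascending-weakenʳ : ∀ {a c d ps} → c ≤ d → Ascending a c ps → Ascending a d ps
Ascending-weakenʳ c≤d []                  = []
Ascending-weakenʳ c≤d ((a≤p , p<c) ∷ asc) = (a≤p , <-≤-trans p<c c≤d) ∷ Ascending-weakenʳ c≤d asc

Ascending-++ : ∀ {a b c xs ys} → a ≤ b → b ≤ c → Ascending a b xs → Ascending b c ys →
               Ascending a c (xs ++ ys)
Ascending-++ a≤b b≤c []                  ys = Ascending-weakenˡ a≤b ys
Ascending-++ a≤b b≤c ((a≤p , p<b) ∷ xs) ys = (a≤p , <-≤-trans p<b b≤c) ∷ Ascending-++ p<b b≤c xs ys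

Ascending-lowerBound : ∀ {a c ps i} → Ascending a c ps → i < length ps → a ≤ nth ps i
Ascending-lowerBound {i = zero}  ((a≤p , _) ∷ _)   _         = a≤p
Ascending-lowerBound {i = suc i} ((a≤p , _) ∷ asc) (s≤s i<n) = ≤-trans a≤p (<⇒≤ (Ascending-lowerBound asc i<n))

Ascending-nth-< : ∀ {a c ps i j} → Ascending a c ps → i < j → j < length ps → nth ps i < nth ps j
Ascending-nth-< {i = zero}  {suc j} (_ ∷ asc) _         (s≤s j<n) = Ascending-lowerBound asc j<n
Ascending-nth-< {i = suc i} {suc j} (_ ∷ asc) (s≤s i<j) (s≤s j<n) = Ascending-nth-< asc i<j j<n

record Collision (xs ys : List ℕ) : Set where
  constructor collision
  field
    rank₁ rank₂  : ℕ
    ranks-differ : rank₁ ≢ rank₂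
    rank₁<length : rank₁ < length xs
    rank₂<length : rank₂ < length ys
    common       : nth xs rank₁ ≡ nth ys rank₂

Collision-++ : ∀ {xs xs′} ys ys′ → Collision xs xs′ → Collision (xs ++ ys) (xs′ ++ ys′)
Collision-++ {xs} {xs′} ys ys′ (collision a b a≢b a<n b<n eq) =
  collision a b a≢b (<-≤-trans a<n (length-++-≤ˡ xs)) (<-≤-trans b<n (length-++-≤ˡ xs′))
    (trans (nth-++ˡ xs ys a<n) (trans eq (sym (nth-++ˡ xs′ ys′ b<n))))

Collision-∷ : ∀ xs y y′ {ys ys′} → Collision ys ys′ → Collision (xs ++ y ∷ ys) (xs ++ y′ ∷ ys′)
Collision-∷ xs y y′ {ys} {ys′} (collision a b a≢b a<n b<n eq) =
  collision (length xs + suc a) (length xs + suc b) (a≢b ∘ suc-injective ∘ +-cancelˡ-≡ (length xs) _ _)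
    (shift a<n) (shift b<n)
    (trans (nth-++-∷ʳ xs y ys a) (trans eq (sym (nth-++-∷ʳ xs y′ ys′ b))))
  where
  shift : ∀ {i z zs} → i < length zs → length xs + suc i < length (xs ++ z ∷ zs)
  shift i<n = subst (_ <_) (sym (length-++ xs)) (+-monoʳ-< (length xs) (s≤s i<n))

Collision-roots : ∀ xs xs′ {y y′} ys ys′ → length xs ≢ length xs′ → y ≡ y′ →
                  Collision (xs ++ y ∷ ys) (xs′ ++ y′ ∷ ys′)
Collision-roots xs xs′ ys ys′ n≢n′ y≡y′ =
  collision (length xs) (length xs′) n≢n′ (within xs ys) (within xs′ ys′)
    (trans (nth-++-length xs _ ys) (trans y≡y′ (sym (nth-++-length xs′ _ ys′))))
  where
  within : ∀ zs ws {w} → length zs < length (zs ++ w ∷ ws)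
  within zs ws = subst (_ <_) (sym (length-++ zs)) (m<m+n (length zs) z<s)

width : ℕ → ℕ
width zero    = 0
width (suc m) = suc (width m + width m)

width-mono-≤ : ∀ {m n} → m ≤ n → width m ≤ width n
width-mono-≤ z≤n       = z≤n
width-mono-≤ (s≤s m≤n) = s≤s (+-mono-≤ (width-mono-≤ m≤n) (width-mono-≤ m≤n))

layout : Tree → ℕ → List ℕ
layout leaf       o = []
layout (node l r) o = layout l o ++ o + width (size l + size r) ∷ layout r (suc (o + width (size l + size r)))

length-layout : ∀ t o → length (layout t o) ≡ size t
length-layout leaf       o = refl
length-layout (node l r) o = begin
  length (layout l o ++ _ ∷ layout r _)           ≡⟨ length-++ (layout l o) ⟩
  length (layout l o) + suc (length (layout r _)) ≡⟨ cong₂ (λ x y → x + suc y) (length-layout l o) (length-layout r _) ⟩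
  size l + suc (size r)                           ≡⟨ +-suc (size l) (size r) ⟩
  suc (size l + size r)                           ∎

Ascending-layout : ∀ t o → Ascending o (o + width (size t)) (layout t o)
Ascending-layout leaf       o = []
Ascending-layout (node l r) o =
  Ascending-++ (m≤m+n o w) (<⇒≤ root<end)
    (Ascending-weakenʳ (+-monoʳ-≤ o (width-mono-≤ (m≤m+n (size l) (size r)))) (Ascending-layout l o))
    ((≤-refl , root<end) ∷ Ascending-weakenʳ right≤end (Ascending-layout r (suc (o + w))))
  where
  w : ℕ
  w = width (size l + size r)
  root<end : o + w < o + suc (w + w)
  root<end = +-monoʳ-< o (s≤s (m≤m+n w w))
  right≤end : suc (o + w) + width (size r) ≤ o + suc (w + w)
  right≤end = subst₂ _≤_ (cong suc (sym (+-assoc o w _))) (sym (+-suc o (w + w)))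
    (s≤s (+-monoʳ-≤ o (+-monoʳ-≤ w (width-mono-≤ (m≤n+m (size r) (size l))))))

layout-collision : ∀ t t′ o → size t ≡ size t′ → t ≢ t′ → Collision (layout t o) (layout t′ o)
layout-collision leaf       leaf         o _  t≢t′ = contradiction refl t≢t′
layout-collision (node l r) (node l′ r′) o eq t≢t′ with size l ≟ size l′ | l ≟ᵀ l′
... | no  sl≢sl′ | _ =
  Collision-roots (layout l o) (layout l′ o) _ _
    (λ e → sl≢sl′ (trans (sym (length-layout l o)) (trans e (length-layout l′ o))))
    (cong (λ m → o + width m) (suc-injective eq))
... | yes sl≡sl′ | no l≢l′ = Collision-++ _ _ (layout-collision l l′ o sl≡sl′ l≢l′)
... | yes _      | yes refl =
  Collision-∷ (layout l o) _ _
    (subst (λ m → Collision (layout r root) (layout r′ (suc (o + width (size l + m))))) sr≡sr′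
      (layout-collision r r′ root sr≡sr′ λ { refl → t≢t′ refl }))
  where
  sr≡sr′ : size r ≡ size r′
  sr≡sr′ = +-cancelˡ-≡ (size l) _ _ (suc-injective eq)
  root : ℕ
  root = suc (o + width (size l + size r))

module Transposition {a} {A : Set a} (_≟_ : DecidableEquality A) where

  transpose : A → A → A → A
  transpose x y z with z ≟ x
  ... | yes _ = y
  ... | no  _ with z ≟ y
  ...   | yes _ = x
  ...   | no  _ = z

  transpose-ˡ : ∀ x y → transpose x y x ≡ y
  transpose-ˡ x y with x ≟ x
  ... | yes _   = refl
  ... | no  x≢x = contradiction refl x≢x

  transpose-ʳ : ∀ x y → transpose x y y ≡ x
  transpose-ʳ x y with y ≟ x
  ... | yes y≡x = y≡x
  ... | no  _ with y ≟ y
  ...   | yes _   = refl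
  ...   | no  y≢y = contradiction refl y≢y

  transpose-fix : ∀ {x y z} → z ≢ x → z ≢ y → transpose x y z ≡ z
  transpose-fix {x} {y} {z} z≢x z≢y with z ≟ x
  ... | yes z≡x = contradiction z≡x z≢x
  ... | no  _ with z ≟ y
  ...   | yes z≡y = contradiction z≡y z≢y
  ...   | no  _   = refl

  transpose-involutive : ∀ x y z → transpose x y (transpose x y z) ≡ z
  transpose-involutive x y z with z ≟ x
  ... | yes refl = transpose-ʳ z y
  ... | no  z≢x with z ≟ y
  ...   | yes refl = transpose-ˡ x z
  ...   | no  z≢y  = transpose-fix z≢x z≢y

  transposition : A → A → A ↔ A
  transposition x y = mk↔ₛ′ (transpose x y) (transpose x y) (transpose-involutive x y) (transpose-involutive x y)

open Transposition Data.Nat._≟_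

placing : ℕ → List ℕ → ℕ ↔ ℕ
placing v []       = ↔-id ℕ
placing v (p ∷ ps) = placing (suc v) ps ↔-∘ transposition v p

placing-fix : ∀ {v a c ps x} → x < v → x < a → Ascending a c ps → Inverse.to (placing v ps) x ≡ x
placing-fix x<v x<a [] = refl
placing-fix {v} {ps = p ∷ ps} {x} x<v x<a ((a≤p , _) ∷ asc) =
  trans (cong (Inverse.to (placing (suc v) ps)) (transpose-fix (<⇒≢ x<v) (<⇒≢ x<p)))
        (placing-fix (m<n⇒m<1+n x<v) (m<n⇒m<1+n x<p) asc)
  where
  x<p : x < p
  x<p = <-≤-trans x<a a≤p

placing-nth : ∀ {v a c ps i} → v ≤ a → Ascending a c ps → i < length ps →
              Inverse.to (placing v ps) (nth ps i) ≡ v + i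
placing-nth {v} {ps = p ∷ ps} {zero} v≤a ((a≤p , _) ∷ asc) _ =
  trans (cong (Inverse.to (placing (suc v) ps)) (transpose-ʳ v p))
        (trans (placing-fix (n<1+n v) (s≤s (≤-trans v≤a a≤p)) asc) (sym (+-identityʳ v)))
placing-nth {v} {ps = p ∷ ps} {suc i} v≤a ((a≤p , _) ∷ asc) (s≤s i<n) =
  trans (cong (Inverse.to (placing (suc v) ps)) (transpose-fix (>⇒≢ v<x) (>⇒≢ p<x)))
        (trans (placing-nth (s≤s (≤-trans v≤a a≤p)) asc i<n) (sym (+-suc v i)))
  where
  p<x : p < nth ps i
  p<x = Ascending-lowerBound asc i<n
  v<x : v < nth ps i
  v<x = ≤-<-trans (≤-trans v≤a a≤p) p<x

arrangement : List ℕ → InfPerm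
arrangement ps = ↔⇒⤖ (placing 0 ps)

module _ {n c ps} (asc : Ascending 0 c ps) (length≡n : length ps ≡ n) where

  entry-arrangement-nth : ∀ {i} → i < n → entry (arrangement ps) (nth ps i) ≡ i
  entry-arrangement-nth i<n = placing-nth z≤n asc (subst (_ <_) (sym length≡n) i<n)

  position-in-arrangement : ∀ {j} → entry (arrangement ps) j < n → j ≡ nth ps (entry (arrangement ps) j)
  position-in-arrangement e<n = Bijection.injective (arrangement ps) (sym (entry-arrangement-nth e<n))

  IdOrdered-arrangement : IdOrdered n (arrangement ps)
  IdOrdered-arrangement i j ei<n ej<n ei<ej =
    subst₂ _<_ (sym (position-in-arrangement ei<n)) (sym (position-in-arrangement ej<n))
      (Ascending-nth-< asc ei<ej (subst (_ <_) (sym length≡n) ej<n))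

KnDifferent-arrangement : ∀ {n c c′ xs ys} → Ascending 0 c xs → Ascending 0 c′ ys →
                          length xs ≡ n → length ys ≡ n → Collision xs ys →
                          KnDifferent n (arrangement xs) (arrangement ys)
KnDifferent-arrangement {xs = xs} {ys} ascx ascy refl ys≡xs (collision a b a≢b a<n b<n eq) =
  nth xs a ,
  (λ e → a≢b (trans (sym ea) (trans e eb))) ,
  subst (_< length xs) (sym ea) a<n ,
  subst (_< length xs) (sym eb) b<n′
  where
  b<n′ : b < length xs
  b<n′ = subst (b <_) ys≡xs b<n
  ea : entry (arrangement xs) (nth xs a) ≡ a
  ea = entry-arrangement-nth ascx refl a<n
  eb : entry (arrangement ys) (nth xs a) ≡ b
  eb = trans (cong (entry (arrangement ys)) eq) (entry-arrangement-nth ascy ys≡xs b<n′)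

proposition8 : (n : ℕ) → n ≥ 1 → KappaIdAtLeast n (Catalan n)
proposition8 n _ = permutation , ordered , different
  where
  tree : Fin (Catalan n) → Tree
  tree = catalanTree n
  layoutOf : Fin (Catalan n) → List ℕ
  layoutOf k = layout (tree k) 0
  ascending : ∀ k → Ascending 0 (width (size (tree k))) (layoutOf k)
  ascending k = Ascending-layout (tree k) 0
  length-layoutOf : ∀ k → length (layoutOf k) ≡ n
  length-layoutOf k = trans (length-layout (tree k) 0) (size-catalanTree n k)
  permutation : Fin (Catalan n) → InfPerm
  permutation = arrangement ∘ layoutOf
  ordered : ∀ k → IdOrdered n (permutation k)
  ordered k = IdOrdered-arrangement (ascending k) (length-layoutOf k)
  different : ∀ k l → k ≢ l → KnDifferent n (permutation k) (permutation l)
  different k l k≢l =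
    KnDifferent-arrangement (ascending k) (ascending l) (length-layoutOf k) (length-layoutOf l)
      (layout-collision (tree k) (tree l) 0 (trans (size-catalanTree n k) (sym (size-catalanTree n l)))
        (k≢l ∘ catalanTree-injective n))
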